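{- Let $q=p^m$ with $p$ prime and $m\ge 1$, and let $q-1=ls$ with $l,s$ positive integers. Let $\gamma$ be a primitive element of $\mathbb{F}_q$ and $\xi=\gamma^s$ (a primitive $l$-th root of unity). Let $r\in\mathbb{N}$ and $f\in\mathbb{F}_q[x]$, and put $A_i=f(\xi^i)$ for $0\le i\le l-1$. If $P(x)=x^rf(x^s)$ is a permutation polynomial of $\mathbb{F}_q$, then $l \mid 2\,\mathrm{Ind}_\gamma(A_0A_1\cdots A_{l-1})$.
   Context: For $a\in\mathbb{F}_q^\ast$, $\mathrm{Ind}_\gamma(a)$ denotes the residue class $b \bmod (q-1)$ such that $a=\gamma^b$. Since $l\mid q-1$, divisibility of $\mathrm{Ind}_\gamma(a)$ (or of its multiples) by $l$ is well defined. A polynomial is a permutation polynomial of $\mathbb{F}_q$ if the map $c\mapsto P(c)$ is a bijection of $\mathbb{F}_q$. (When $P$ is a permutation polynomial, all $A_i$ are nonzero, so the index is defined.) -}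

module Defs where

open import Level using (_⊔_)
open import Algebra.Bundles using (CommutativeRing)
open import Data.Nat using (ℕ; zero; suc; _<_; _∸_)
open import Data.Fin using (Fin)
open import Data.List using (List; []; _∷_)
open import Data.Product using (∃; _×_)
open import Function.Bundles using (Bijection)
import Relation.Binary.PropositionalEquality as ≡
open import Relation.Nullary using (¬_)

record IsFiniteField {c ℓ} (R : CommutativeRing c ℓ) (q : ℕ) : Set (c ⊔ ℓ) where
  open CommutativeRing R
  field
    0≉1     : ¬ (0# ≈ 1#)
    inverse : ∀ x → ¬ (x ≈ 0#) → ∃ λ y → x * y ≈ 1#
    card    : Bijection (≡.setoid (Fin q)) setoid

module _ {c ℓ} (R : CommutativeRing c ℓ) where
  open CommutativeRing R

  pow : Carrier → ℕ → Carrier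
  pow x zero    = 1#
  pow x (suc n) = x * pow x n

  -- polynomial given by its coefficient list (constant term first),
  -- evaluated by Horner's rule
  eval : List Carrier → Carrier → Carrier
  eval []       x = 0#
  eval (a ∷ as) x = a + x * eval as x

  prod : (ℕ → Carrier) → ℕ → Carrier
  prod A zero    = 1#
  prod A (suc n) = prod A n * A n

  IsPrimitive : ℕ → Carrier → Set ℓ
  IsPrimitive q γ = (pow γ (q ∸ 1) ≈ 1#)
                  × (∀ k → 0 < k → k < q ∸ 1 → ¬ (pow γ k ≈ 1#))

  IsPermutation : (Carrier → Carrier) → Set (c ⊔ ℓ)
  IsPermutation P = (∀ x y → P x ≈ P y → x ≈ y) × (∀ y → ∃ λ x → P x ≈ y)

module Submission where

-- A permutation polynomial P fixes 0: every nonzero x is some γ^k, and P(γ^k) = γ^(k r) A_k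
-- with A_k a factor of (A_0 ⋯ A_(l−1))^s = γ^(b s) ≠ 0. Hence P permutes γ^0, …, γ^(n−1),
-- n = q − 1 = l s, and comparing ∏ P(γ^k) = γ^(r n(n−1)/2 + b s) with ∏ γ^k = γ^(n(n−1)/2)
-- gives r n(n−1)/2 + b s ≡ n(n−1)/2 (mod n); doubling and dividing by s yields l ∣ 2 b.

open import Defs
open import Algebra.Bundles using (CommutativeRing)
import Data.Nat
open import Data.Nat using (ℕ; _^_; _∸_; _≤_)
open import Data.Nat.Divisibility using (_∣_)
open import Data.Nat.Primality using (Prime)
open import Data.List using (List)
open import Relation.Binary.PropositionalEquality using (_≡_)

open import Data.Nat as ℕ using (zero; suc; _<_; NonZero; z≤n; s≤s)
import Data.Nat.Properties as ℕₚ
open import Data.Nat.DivMod using (_%_; _/_; m≡m%n+[m/n]*n; m%n<n)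
open import Data.Nat.Divisibility using (∣m+n∣m⇒∣n; m∣m*n)
open import Data.Nat.Tactic.RingSolver using (solve; solve-∀)
open import Data.Fin as Fin using (Fin; toℕ)
import Data.Fin.Properties as Fin
open import Data.List using ([]; _∷_)
open import Data.Product using (∃; _×_; _,_; proj₁; proj₂)
open import Data.Sum using (inj₁; inj₂)
open import Data.Empty using (⊥-elim)
open import Function.Bundles using (Bijection; mk↔ₛ′)
open import Relation.Nullary using (¬_; Dec; yes; no)
import Relation.Binary.PropositionalEquality as ≡
open ≡ using (cong)
import Algebra.Properties.CommutativeSemiring.Exp as Exp
import Algebra.Properties.CommutativeMonoid.Sum as Sum

module _ where
  open import Data.Nat using (_+_; _*_)

  triangle : ℕ → ℕ
  triangle zero    = 0
  triangle (suc n) = triangle n + n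

  2*triangle+n≡n*n : ∀ n → 2 * triangle n + n ≡ n * n
  2*triangle+n≡n*n zero    = ≡.refl
  2*triangle+n≡n*n (suc n) = begin
    2 * (triangle n + n) + suc n        ≡⟨ regroup (triangle n) n ⟩
    (2 * triangle n + n) + (2 * n + 1)  ≡⟨ cong (_+ (2 * n + 1)) (2*triangle+n≡n*n n) ⟩
    n * n + (2 * n + 1)                 ≡⟨ solve (n ∷ []) ⟩
    suc n * suc n                       ∎
    where
    open ≡.≡-Reasoning
    regroup : ∀ t n → 2 * (t + n) + suc n ≡ (2 * t + n) + (2 * n + 1)
    regroup = solve-∀

  m%n≡o%n⇒m+[o/n]*n≡o+[m/n]*n : ∀ m o n .{{_ : NonZero n}} →
    m % n ≡ o % n → m + (o / n) * n ≡ o + (m / n) * n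
  m%n≡o%n⇒m+[o/n]*n≡o+[m/n]*n m o n eq = begin
    m + (o / n) * n                    ≡⟨ cong (_+ (o / n) * n) (m≡m%n+[m/n]*n m n) ⟩
    m % n + (m / n) * n + (o / n) * n  ≡⟨ cong (λ z → z + (m / n) * n + (o / n) * n) eq ⟩
    o % n + (m / n) * n + (o / n) * n  ≡⟨ swap (o % n) ((m / n) * n) ((o / n) * n) ⟩
    o % n + (o / n) * n + (m / n) * n  ≡⟨ cong (_+ (m / n) * n) (m≡m%n+[m/n]*n o n) ⟨
    o + (m / n) * n                    ∎
    where
    open ≡.≡-Reasoning
    swap : ∀ x y z → x + y + z ≡ x + z + y
    swap = solve-∀

  -- Here n = l s, t = n (n − 1) / 2 and the last hypothesis is t r + b s ≡ t (mod n):
  -- doubled and divided by s it reads l (n − 1) r + 2 b ≡ l (n − 1) (mod 2 l).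
  ∣2*-of-congruence : ∀ l s r b t c₁ c₂ .{{_ : NonZero s}} →
    2 * t + l * s ≡ (l * s) * (l * s) →
    t * r + b * s + c₁ * (l * s) ≡ t + c₂ * (l * s) →
    l ∣ 2 * b
  ∣2*-of-congruence l s r b t c₁ c₂ triangular congruent =
    ∣m+n∣m⇒∣n (≡.subst (l ∣_) (≡.sym divided) (m∣m*n _)) (m∣m*n _)
    where
    open ≡.≡-Reasoning
    doubled : s * (l * (l * s * r + 2 * c₁ + 1) + 2 * b) ≡ s * (l * (l * s + 2 * c₂ + r))
    doubled = begin
      s * (l * (l * s * r + 2 * c₁ + 1) + 2 * b)
        ≡⟨ solve (l ∷ s ∷ r ∷ b ∷ c₁ ∷ []) ⟩
      (l * s) * (l * s) * r + 2 * (b * s) + 2 * c₁ * (l * s) + l * s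
        ≡⟨ cong (λ z → z * r + 2 * (b * s) + 2 * c₁ * (l * s) + l * s) triangular ⟨
      (2 * t + l * s) * r + 2 * (b * s) + 2 * c₁ * (l * s) + l * s
        ≡⟨ solve (l ∷ s ∷ r ∷ b ∷ t ∷ c₁ ∷ []) ⟩
      2 * (t * r + b * s + c₁ * (l * s)) + l * s * r + l * s
        ≡⟨ cong (λ z → 2 * z + l * s * r + l * s) congruent ⟩
      2 * (t + c₂ * (l * s)) + l * s * r + l * s
        ≡⟨ solve (l ∷ s ∷ r ∷ t ∷ c₂ ∷ []) ⟩
      (2 * t + l * s) + 2 * c₂ * (l * s) + l * s * r
        ≡⟨ cong (λ z → z + 2 * c₂ * (l * s) + l * s * r) triangular ⟩
      (l * s) * (l * s) + 2 * c₂ * (l * s) + l * s * r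
        ≡⟨ solve (l ∷ s ∷ r ∷ c₂ ∷ []) ⟩
      s * (l * (l * s + 2 * c₂ + r))
        ∎
    divided : l * (l * s * r + 2 * c₁ + 1) + 2 * b ≡ l * (l * s + 2 * c₂ + r)
    divided = ℕₚ.*-cancelˡ-≡ _ _ s doubled

module CommutativeRingProperties {c ℓ} (R : CommutativeRing c ℓ) where
  open CommutativeRing R
  open Exp commutativeSemiring renaming (_^_ to _^ᴿ_)
  open import Algebra.Properties.CommutativeSemigroup *-commutativeSemigroup using (interchange)
  open import Relation.Binary.Reasoning.Setoid setoid

  pow≡^ : ∀ x n → pow R x n ≡ x ^ᴿ n
  pow≡^ x zero    = ≡.refl
  pow≡^ x (suc n) = cong (x *_) (pow≡^ x n)

  pow-cong : ∀ {x y} n → x ≈ y → pow R x n ≈ pow R y n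
  pow-cong {x} {y} n x≈y rewrite pow≡^ x n | pow≡^ y n = ^-congˡ n x≈y

  pow-+ : ∀ x m n → pow R x (m ℕ.+ n) ≈ pow R x m * pow R x n
  pow-+ x m n rewrite pow≡^ x (m ℕ.+ n) | pow≡^ x m | pow≡^ x n = ^-homo-* x m n

  pow-* : ∀ x m n → pow R x (m ℕ.* n) ≈ pow R (pow R x m) n
  pow-* x m n rewrite pow≡^ x (m ℕ.* n) | pow≡^ x m | pow≡^ (x ^ᴿ m) n = sym (^-assocʳ x m n)

  pow-distrib-* : ∀ x y n → pow R (x * y) n ≈ pow R x n * pow R y n
  pow-distrib-* x y n rewrite pow≡^ (x * y) n | pow≡^ x n | pow≡^ y n = ^-distrib-* x y n

  pow-1# : ∀ n → pow R 1# n ≈ 1#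
  pow-1# zero    = refl
  pow-1# (suc n) = trans (*-identityˡ _) (pow-1# n)

  pow-zeroˡ : ∀ n .{{_ : NonZero n}} → pow R 0# n ≈ 0#
  pow-zeroˡ (suc n) = zeroˡ _

  eval-cong : ∀ g {x y} → x ≈ y → eval R g x ≈ eval R g y
  eval-cong []      x≈y = refl
  eval-cong (a ∷ g) x≈y = +-congˡ (*-cong x≈y (eval-cong g x≈y))

  prod-cong : ∀ {A B} n → (∀ i → A i ≈ B i) → prod R A n ≈ prod R B n
  prod-cong zero    A≈B = refl
  prod-cong (suc n) A≈B = *-cong (prod-cong n A≈B) (A≈B n)

  prod-distrib-* : ∀ A B n → prod R (λ i → A i * B i) n ≈ prod R A n * prod R B n
  prod-distrib-* A B zero    = sym (*-identityˡ 1#)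
  prod-distrib-* A B (suc n) = begin
    prod R (λ i → A i * B i) n * (A n * B n)      ≈⟨ *-congʳ (prod-distrib-* A B n) ⟩
    (prod R A n * prod R B n) * (A n * B n)       ≈⟨ interchange _ _ _ _ ⟩
    (prod R A n * A n) * (prod R B n * B n)       ∎

  prod-pow : ∀ A r n → prod R (λ i → pow R (A i) r) n ≈ pow R (prod R A n) r
  prod-pow A r zero    = sym (pow-1# r)
  prod-pow A r (suc n) = trans (*-congʳ (prod-pow A r n)) (sym (pow-distrib-* _ _ r))

  prod-+ : ∀ A m n → prod R A (m ℕ.+ n) ≈ prod R A m * prod R (λ i → A (m ℕ.+ i)) n
  prod-+ A m zero    rewrite ℕₚ.+-identityʳ m = sym (*-identityʳ _)
  prod-+ A m (suc n) rewrite ℕₚ.+-suc m n = trans (*-congʳ (prod-+ A m n)) (*-assoc _ _ _)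

  prod-periodic : ∀ A l → (∀ i → A (l ℕ.+ i) ≈ A i) → ∀ k → prod R A (k ℕ.* l) ≈ pow R (prod R A l) k
  prod-periodic A l periodic zero    = refl
  prod-periodic A l periodic (suc k) = begin
    prod R A (l ℕ.+ k ℕ.* l)                           ≈⟨ prod-+ A l (k ℕ.* l) ⟩
    prod R A l * prod R (λ i → A (l ℕ.+ i)) (k ℕ.* l)  ≈⟨ *-congˡ (prod-cong (k ℕ.* l) periodic) ⟩
    prod R A l * prod R A (k ℕ.* l)                    ≈⟨ *-congˡ (prod-periodic A l periodic k) ⟩
    prod R A l * pow R (prod R A l) k                  ∎

  prod-≈0 : ∀ A {n k} → k < n → A k ≈ 0# → prod R A n ≈ 0#
  prod-≈0 A {suc n} {k} k<1+n Ak≈0 with ℕₚ.m≤n⇒m<n∨m≡n (ℕₚ.≤-pred k<1+n)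
  ... | inj₁ k<n    = trans (*-congʳ (prod-≈0 A k<n Ak≈0)) (zeroˡ _)
  ... | inj₂ ≡.refl = trans (*-congˡ Ak≈0) (zeroʳ _)

  prod-pow≈pow-triangle : ∀ x n → prod R (pow R x) n ≈ pow R x (triangle n)
  prod-pow≈pow-triangle x zero    = refl
  prod-pow≈pow-triangle x (suc n) = trans (*-congʳ (prod-pow≈pow-triangle x n)) (sym (pow-+ x (triangle n) n))

  open Sum *-commutativeMonoid using () renaming (sum to ∏)

  prod≈∏ : ∀ A n → prod R A n ≈ ∏ {n} (λ i → A (toℕ i))
  prod≈∏ A zero    = refl
  prod≈∏ A (suc n) = begin
    prod R A (1 ℕ.+ n)                       ≈⟨ prod-+ A 1 n ⟩
    (1# * A 0) * prod R (λ i → A (suc i)) n  ≈⟨ *-cong (*-identityˡ (A 0)) (prod≈∏ (λ i → A (suc i)) n) ⟩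
    A 0 * ∏ {n} (λ i → A (suc (toℕ i)))      ∎

module FiniteFieldArithmetic {c ℓ} {R : CommutativeRing c ℓ} {q : ℕ} (F : IsFiniteField R q) where
  open CommutativeRing R
  open IsFiniteField F
  open CommutativeRingProperties R
  open import Relation.Binary.Reasoning.Setoid setoid
  open Bijection card using (to; surjective; injective)

  *-cancelˡ : ∀ {x y z} → ¬ x ≈ 0# → x * y ≈ x * z → y ≈ z
  *-cancelˡ {x} {y} {z} x≉0 xy≈xz with inverse x x≉0
  ... | x⁻¹ , xx⁻¹≈1 = trans (sym (undo y)) (trans (*-congˡ xy≈xz) (undo z))
    where
    undo : ∀ w → x⁻¹ * (x * w) ≈ w
    undo w = begin
      x⁻¹ * (x * w)  ≈⟨ *-assoc x⁻¹ x w ⟨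
      (x⁻¹ * x) * w  ≈⟨ *-congʳ (trans (*-comm x⁻¹ x) xx⁻¹≈1) ⟩
      1# * w         ≈⟨ *-identityˡ w ⟩
      w              ∎

  *-≉0 : ∀ {x y} → ¬ x ≈ 0# → ¬ y ≈ 0# → ¬ x * y ≈ 0#
  *-≉0 x≉0 y≉0 xy≈0 = y≉0 (*-cancelˡ x≉0 (trans xy≈0 (sym (zeroʳ _))))

  pow-≉0 : ∀ {x} k → ¬ x ≈ 0# → ¬ pow R x k ≈ 0#
  pow-≉0 zero    x≉0 1≈0 = 0≉1 (sym 1≈0)
  pow-≉0 (suc k) x≉0     = *-≉0 x≉0 (pow-≉0 k x≉0)

  index : Carrier → Fin q
  index y = proj₁ (surjective y)

  to-index : ∀ y → to (index y) ≈ y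
  to-index y = proj₂ (surjective y) ≡.refl

  index-injective : ∀ {x y} → index x ≡ index y → x ≈ y
  index-injective {x} {y} eq = trans (sym (to-index x)) (trans (reflexive (cong to eq)) (to-index y))

  _≈?_ : ∀ x y → Dec (x ≈ y)
  x ≈? y with index x Fin.≟ index y
  ... | yes eq = yes (index-injective eq)
  ... | no neq = no λ x≈y → neq (injective (trans (to-index x) (trans x≈y (sym (to-index y)))))

  permutation-fixes-0 : ∀ {P : Carrier → Carrier} → (∀ {x y} → x ≈ y → P x ≈ P y) → IsPermutation R P →
                        (∀ x → ¬ x ≈ 0# → ¬ P x ≈ 0#) → P 0# ≈ 0#
  permutation-fixes-0 {P} P-cong (_ , P-surjective) nonvanishing with P-surjective 0#
  ... | x , Px≈0 with x ≈? 0#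
  ...   | yes x≈0 = trans (P-cong (sym x≈0)) Px≈0
  ...   | no  x≉0 = ⊥-elim (nonvanishing x x≉0 Px≈0)

module PrimitiveElement {c ℓ} {R : CommutativeRing c ℓ} (n : ℕ) .{{_ : NonZero n}}
                        (F : IsFiniteField R (suc n)) {γ} (γ-primitive : IsPrimitive R (suc n) γ) where
  open CommutativeRing R
  open IsFiniteField F
  open CommutativeRingProperties R
  open FiniteFieldArithmetic F
  open import Relation.Binary.Reasoning.Setoid setoid
  open Sum *-commutativeMonoid using (sum-cong-≋; sum-permute) renaming (sum to ∏)

  γ^n≈1 : pow R γ n ≈ 1#
  γ^n≈1 = proj₁ γ-primitive

  γ^≉0 : ∀ k → ¬ pow R γ k ≈ 0#
  γ^≉0 k = pow-≉0 k λ γ≈0 → 0≉1 (trans (sym (pow-zeroˡ n)) (trans (sym (pow-cong n γ≈0)) γ^n≈1))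

  γ^≈γ^% : ∀ a → pow R γ a ≈ pow R γ (a % n)
  γ^≈γ^% a = begin
    pow R γ a                                    ≡⟨ cong (pow R γ) (m≡m%n+[m/n]*n a n) ⟩
    pow R γ (a % n ℕ.+ (a / n) ℕ.* n)            ≈⟨ pow-+ γ (a % n) _ ⟩
    pow R γ (a % n) * pow R γ ((a / n) ℕ.* n)    ≡⟨ cong (λ k → pow R γ (a % n) * pow R γ k) (ℕₚ.*-comm (a / n) n) ⟩
    pow R γ (a % n) * pow R γ (n ℕ.* (a / n))    ≈⟨ *-congˡ (pow-* γ n (a / n)) ⟩
    pow R γ (a % n) * pow R (pow R γ n) (a / n)  ≈⟨ *-congˡ (trans (pow-cong (a / n) γ^n≈1) (pow-1# (a / n))) ⟩
    pow R γ (a % n) * 1#                         ≈⟨ *-identityʳ _ ⟩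
    pow R γ (a % n)                              ∎

  γ^-injective-≤ : ∀ {a c} → a ≤ c → c < n → pow R γ a ≈ pow R γ c → a ≡ c
  γ^-injective-≤ {a} a≤c c<n γ^a≈γ^c with ℕₚ.m≤n⇒∃[o]m+o≡n a≤c
  ... | zero  , ≡.refl = ≡.sym (ℕₚ.+-identityʳ a)
  ... | suc d , ≡.refl = ⊥-elim (proj₂ γ-primitive (suc d) (s≤s z≤n) (ℕₚ.≤-<-trans (ℕₚ.m≤n+m (suc d) a) c<n) γ^d≈1)
    where
    γ^d≈1 : pow R γ (suc d) ≈ 1#
    γ^d≈1 = sym (*-cancelˡ (γ^≉0 a) (trans (*-identityʳ _) (trans γ^a≈γ^c (pow-+ γ a (suc d)))))

  γ^-injective : ∀ {a c} → a < n → c < n → pow R γ a ≈ pow R γ c → a ≡ c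
  γ^-injective {a} {c} a<n c<n γ^a≈γ^c with ℕₚ.≤-total a c
  ... | inj₁ a≤c = γ^-injective-≤ a≤c c<n γ^a≈γ^c
  ... | inj₂ c≤a = ≡.sym (γ^-injective-≤ c≤a a<n (sym γ^a≈γ^c))

  γ^≈γ^⇒%≡% : ∀ a c → pow R γ a ≈ pow R γ c → a % n ≡ c % n
  γ^≈γ^⇒%≡% a c γ^a≈γ^c =
    γ^-injective (m%n<n a n) (m%n<n c n) (trans (sym (γ^≈γ^% a)) (trans γ^a≈γ^c (γ^≈γ^% c)))

  -- Pigeonhole on the n + 2 elements 0, x, γ^0, …, γ^(n-1) of a field with n + 1 elements.
  ≉0⇒γ^ : ∀ x → ¬ x ≈ 0# → ∃ λ (k : Fin n) → x ≈ pow R γ (toℕ k)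
  ≉0⇒γ^ x x≉0 = resolve (Fin.pigeonhole (ℕₚ.n<1+n (suc n)) (λ i → index (candidate i)))
    where
    candidate : Fin (suc (suc n)) → Carrier
    candidate Fin.zero                = 0#
    candidate (Fin.suc Fin.zero)      = x
    candidate (Fin.suc (Fin.suc k))   = pow R γ (toℕ k)

    collision : ∀ i j → i Fin.< j → candidate i ≈ candidate j → ∃ λ (k : Fin n) → x ≈ pow R γ (toℕ k)
    collision Fin.zero (Fin.suc Fin.zero)     _ 0≈x   = ⊥-elim (x≉0 (sym 0≈x))
    collision Fin.zero (Fin.suc (Fin.suc k))  _ 0≈γ^k = ⊥-elim (γ^≉0 (toℕ k) (sym 0≈γ^k))
    collision (Fin.suc Fin.zero) (Fin.suc Fin.zero) (s≤s ()) _
    collision (Fin.suc Fin.zero) (Fin.suc (Fin.suc k)) _ x≈γ^k = k , x≈γ^k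
    collision (Fin.suc (Fin.suc k)) (Fin.suc (Fin.suc k′)) (s≤s (s≤s k<k′)) γ^k≈γ^k′ =
      ⊥-elim (ℕₚ.<-irrefl (γ^-injective (Fin.toℕ<n k) (Fin.toℕ<n k′) γ^k≈γ^k′) k<k′)

    resolve : (∃ λ i → ∃ λ j → i Fin.< j × index (candidate i) ≡ index (candidate j)) →
              ∃ λ (k : Fin n) → x ≈ pow R γ (toℕ k)
    resolve (i , j , i<j , eq) = collision i j i<j (index-injective eq)

  prod-γ^-permute : ∀ {P : Carrier → Carrier} → (∀ {x y} → x ≈ y → P x ≈ P y) → IsPermutation R P →
                    P 0# ≈ 0# → prod R (λ k → P (pow R γ k)) n ≈ prod R (pow R γ) n
  prod-γ^-permute {P} P-cong (P-injective , P-surjective) P0≈0 = begin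
    prod R (λ k → P (pow R γ k)) n              ≈⟨ prod≈∏ (λ k → P (pow R γ k)) n ⟩
    ∏ {n} (λ k → P (pow R γ (toℕ k)))           ≈⟨ sum-cong-≋ P∘γ^≈γ^∘π ⟩
    ∏ {n} (λ k → pow R γ (toℕ (π k)))           ≈⟨ sum-permute (λ k → pow R γ (toℕ k)) (mk↔ₛ′ π π⁻¹ π∘π⁻¹ π⁻¹∘π) ⟨
    ∏ {n} (λ k → pow R γ (toℕ k))               ≈⟨ prod≈∏ (pow R γ) n ⟨
    prod R (pow R γ) n                          ∎
    where
    γ^-injective-Fin : ∀ {i j : Fin n} → pow R γ (toℕ i) ≈ pow R γ (toℕ j) → i ≡ j
    γ^-injective-Fin {i} {j} eq = Fin.toℕ-injective (γ^-injective (Fin.toℕ<n i) (Fin.toℕ<n j) eq)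

    P∘γ^≉0 : ∀ k → ¬ P (pow R γ k) ≈ 0#
    P∘γ^≉0 k P∘γ^≈0 = γ^≉0 k (P-injective _ _ (trans P∘γ^≈0 (sym P0≈0)))

    π : Fin n → Fin n
    π k = proj₁ (≉0⇒γ^ _ (P∘γ^≉0 (toℕ k)))

    P∘γ^≈γ^∘π : ∀ k → P (pow R γ (toℕ k)) ≈ pow R γ (toℕ (π k))
    P∘γ^≈γ^∘π k = proj₂ (≉0⇒γ^ _ (P∘γ^≉0 (toℕ k)))

    preimage : Fin n → Carrier
    preimage j = proj₁ (P-surjective (pow R γ (toℕ j)))

    P∘preimage : ∀ j → P (preimage j) ≈ pow R γ (toℕ j)
    P∘preimage j = proj₂ (P-surjective (pow R γ (toℕ j)))

    preimage≉0 : ∀ j → ¬ preimage j ≈ 0#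
    preimage≉0 j pj≈0 = γ^≉0 (toℕ j) (trans (sym (P∘preimage j)) (trans (P-cong pj≈0) P0≈0))

    π⁻¹ : Fin n → Fin n
    π⁻¹ j = proj₁ (≉0⇒γ^ _ (preimage≉0 j))

    preimage≈γ^∘π⁻¹ : ∀ j → preimage j ≈ pow R γ (toℕ (π⁻¹ j))
    preimage≈γ^∘π⁻¹ j = proj₂ (≉0⇒γ^ _ (preimage≉0 j))

    π∘π⁻¹ : ∀ j → π (π⁻¹ j) ≡ j
    π∘π⁻¹ j = γ^-injective-Fin (trans (sym (P∘γ^≈γ^∘π (π⁻¹ j)))
                (trans (P-cong (sym (preimage≈γ^∘π⁻¹ j))) (P∘preimage j)))

    π⁻¹∘π : ∀ k → π⁻¹ (π k) ≡ k
    π⁻¹∘π k = γ^-injective-Fin (trans (sym (preimage≈γ^∘π⁻¹ (π k)))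
                (P-injective _ _ (trans (P∘preimage (π k)) (sym (P∘γ^≈γ^∘π k)))))

module PermutationPolynomial
  {c ℓ} {R : CommutativeRing c ℓ} (l s : ℕ) .{{_ : NonZero (l ℕ.* s)}}
  (F : IsFiniteField R (suc (l ℕ.* s)))
  {γ : CommutativeRing.Carrier R} (γ-primitive : IsPrimitive R (suc (l ℕ.* s)) γ)
  (r : ℕ) (f : List (CommutativeRing.Carrier R))
  (P-permutation : IsPermutation R (λ x → CommutativeRing._*_ R (pow R x r) (eval R f (pow R x s))))
  (b : ℕ) (γ^b≈∏A : CommutativeRing._≈_ R (pow R γ b) (prod R (λ i → eval R f (pow R (pow R γ s) i)) l))
  where

  open CommutativeRing R
  open CommutativeRingProperties R
  open FiniteFieldArithmetic F
  open PrimitiveElement (l ℕ.* s) F γ-primitive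
  open import Relation.Binary.Reasoning.Setoid setoid

  private
    n : ℕ
    n = l ℕ.* s

  P : Carrier → Carrier
  P x = pow R x r * eval R f (pow R x s)

  ξ : Carrier
  ξ = pow R γ s

  A : ℕ → Carrier
  A i = eval R f (pow R ξ i)

  P-cong : ∀ {x y} → x ≈ y → P x ≈ P y
  P-cong x≈y = *-cong (pow-cong r x≈y) (eval-cong f (pow-cong s x≈y))

  P∘γ^ : ∀ k → P (pow R γ k) ≈ pow R (pow R γ k) r * A k
  P∘γ^ k = *-congˡ (eval-cong f (begin
    pow R (pow R γ k) s  ≈⟨ pow-* γ k s ⟨
    pow R γ (k ℕ.* s)    ≡⟨ cong (pow R γ) (ℕₚ.*-comm k s) ⟩
    pow R γ (s ℕ.* k)    ≈⟨ pow-* γ s k ⟩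
    pow R ξ k            ∎))

  ξ^l≈1 : pow R ξ l ≈ 1#
  ξ^l≈1 = begin
    pow R (pow R γ s) l  ≈⟨ pow-* γ s l ⟨
    pow R γ (s ℕ.* l)    ≡⟨ cong (pow R γ) (ℕₚ.*-comm s l) ⟩
    pow R γ n            ≈⟨ γ^n≈1 ⟩
    1#                   ∎

  A-periodic : ∀ i → A (l ℕ.+ i) ≈ A i
  A-periodic i = eval-cong f (begin
    pow R ξ (l ℕ.+ i)        ≈⟨ pow-+ ξ l i ⟩
    pow R ξ l * pow R ξ i    ≈⟨ *-congʳ ξ^l≈1 ⟩
    1# * pow R ξ i           ≈⟨ *-identityˡ _ ⟩
    pow R ξ i                ∎)

  prod-A : prod R A n ≈ pow R (pow R γ b) s
  prod-A = begin
    prod R A n                ≡⟨ cong (prod R A) (ℕₚ.*-comm l s) ⟩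
    prod R A (s ℕ.* l)        ≈⟨ prod-periodic A l A-periodic s ⟩
    pow R (prod R A l) s      ≈⟨ pow-cong s γ^b≈∏A ⟨
    pow R (pow R γ b) s       ∎

  A≉0 : ∀ k → k < n → ¬ A k ≈ 0#
  A≉0 k k<n Ak≈0 = pow-≉0 s (γ^≉0 b) (trans (sym prod-A) (prod-≈0 A k<n Ak≈0))

  P≉0 : ∀ x → ¬ x ≈ 0# → ¬ P x ≈ 0#
  P≉0 x x≉0 Px≈0 with ≉0⇒γ^ x x≉0
  ... | k , x≈γ^k = *-≉0 (pow-≉0 r (γ^≉0 (toℕ k))) (A≉0 (toℕ k) (Fin.toℕ<n k))
                      (trans (sym (P∘γ^ (toℕ k))) (trans (P-cong (sym x≈γ^k)) Px≈0))

  prod-P∘γ^ : prod R (λ k → P (pow R γ k)) n ≈ pow R γ (triangle n ℕ.* r ℕ.+ b ℕ.* s)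
  prod-P∘γ^ = begin
    prod R (λ k → P (pow R γ k)) n                           ≈⟨ prod-cong n P∘γ^ ⟩
    prod R (λ k → pow R (pow R γ k) r * A k) n               ≈⟨ prod-distrib-* _ A n ⟩
    prod R (λ k → pow R (pow R γ k) r) n * prod R A n        ≈⟨ *-cong (prod-pow (pow R γ) r n) prod-A ⟩
    pow R (prod R (pow R γ) n) r * pow R (pow R γ b) s       ≈⟨ *-congʳ (pow-cong r (prod-pow≈pow-triangle γ n)) ⟩
    pow R (pow R γ (triangle n)) r * pow R (pow R γ b) s     ≈⟨ *-cong (pow-* γ (triangle n) r) (pow-* γ b s) ⟨
    pow R γ (triangle n ℕ.* r) * pow R γ (b ℕ.* s)           ≈⟨ pow-+ γ (triangle n ℕ.* r) (b ℕ.* s) ⟨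
    pow R γ (triangle n ℕ.* r ℕ.+ b ℕ.* s)                   ∎

  index-congruence : (triangle n ℕ.* r ℕ.+ b ℕ.* s) % n ≡ triangle n % n
  index-congruence = γ^≈γ^⇒%≡% _ _ (begin
    pow R γ (triangle n ℕ.* r ℕ.+ b ℕ.* s)  ≈⟨ prod-P∘γ^ ⟨
    prod R (λ k → P (pow R γ k)) n          ≈⟨ prod-γ^-permute P-cong P-permutation P0≈0 ⟩
    prod R (pow R γ) n                      ≈⟨ prod-pow≈pow-triangle γ n ⟩
    pow R γ (triangle n)                    ∎)
    where
    P0≈0 : P 0# ≈ 0#
    P0≈0 = permutation-fixes-0 P-cong P-permutation P≉0

theorem2p5 : ∀ {c ℓ} (R : CommutativeRing c ℓ) →
    let open CommutativeRing R in
    (p m q l s : ℕ) → Prime p → 1 ≤ m → q ≡ p ^ m →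
    IsFiniteField R q →
    1 ≤ l → 1 ≤ s → q ∸ 1 ≡ l Data.Nat.* s →
    (γ : Carrier) → IsPrimitive R q γ →
    (r : ℕ) (f : List Carrier) →
    IsPermutation R (λ x → pow R x r * eval R f (pow R x s)) →
    (b : ℕ) → pow R γ b ≈ prod R (λ i → eval R f (pow R (pow R γ s) i)) l →
    l ∣ 2 Data.Nat.* b
theorem2p5 R p m (suc .(suc _)) l@(suc _) s@(suc _) _ _ _ F (s≤s z≤n) (s≤s z≤n) ≡.refl
           γ γ-primitive r f P-permutation b γ^b≈∏A =
  ∣2*-of-congruence l s r b t (t / n) (t*r+b*s / n) (2*triangle+n≡n*n n)
    (m%n≡o%n⇒m+[o/n]*n≡o+[m/n]*n t*r+b*s t n
      (PermutationPolynomial.index-congruence l s F γ-primitive r f P-permutation b γ^b≈∏A))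
  where
  n t t*r+b*s : ℕ
  n = l ℕ.* s
  t = triangle n
  t*r+b*s = t ℕ.* r ℕ.+ b ℕ.* s
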